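{- Let $G$ be a finite connected simple graph with minimum degree $\delta(G)\ge 2$ that is not isomorphic to the $4$-cycle $C_4$. Then $FD(G)>2$.
   Context: A set $D\subseteq V(G)$ is dominating if every vertex not in $D$ has a neighbour in $D$. For positive integers $k,s$, a $(k,s)$-configuration of $G$ is a multiset of $k$ (not necessarily distinct) dominating sets of $G$ such that every vertex belongs to at most $s$ of them. The fractional domatic number $FD(G)$ is the maximum of $k/s$ over all $(k,s)$ for which $G$ admits a $(k,s)$-configuration. -}

module Defs where

open import Data.Nat using (ℕ; zero; suc; _≤_; _<_; _*_)
open import Data.Bool using (Bool; true; false; T)
open import Data.Fin using (Fin; zero; suc)
open import Data.Fin.Subset using (Subset; _∈_; _∉_; ∣_∣)
open import Data.Vec using (Vec; []; _∷_; tabulate; count)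
open import Data.Vec.Relation.Unary.All using (All)
open import Data.Product using (Σ; ∃; ∃-syntax; _×_; _,_)
open import Data.Nat using (ℕ)
open import Data.List using (List; []; _∷_)
open import Relation.Nullary using (¬_; Dec; yes; no)
open import Relation.Binary.PropositionalEquality using (_≡_)
open import Function.Bundles using (_↔_; Inverse)
open import Data.Empty using (⊥)

record Graph (n : ℕ) : Set where
  field
    adj     : Fin n → Fin n → Bool
    sym     : ∀ u v → adj u v ≡ adj v u
    irrefl  : ∀ v → adj v v ≡ false
open Graph public

Adj : ∀ {n} → Graph n → Fin n → Fin n → Set
Adj G u v = T (adj G u v)

N : ∀ {n} → Graph n → Fin n → Subset n
N G v = tabulate (λ u → adj G v u)

degree : ∀ {n} → Graph n → Fin n → ℕ
degree G v = ∣ N G v ∣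

data Walk {n} (G : Graph n) : Fin n → Fin n → Set where
  here : ∀ {v} → Walk G v v
  step : ∀ {u w v} → Adj G u w → Walk G w v → Walk G u v

Connected : ∀ {n} → Graph n → Set
Connected {zero} G = ⊥
Connected {suc n} G = ∀ u v → Walk G u v

MinDegreeAtLeast : ∀ {n} → Graph n → ℕ → Set
MinDegreeAtLeast G d = ∀ v → d ≤ degree G v

Isomorphic : ∀ {n m} → Graph n → Graph m → Set
Isomorphic {n} {m} G H =
  Σ (Fin n ↔ Fin m) λ f →
    ∀ u v → adj G u v ≡ adj H (Inverse.to f u) (Inverse.to f v)

c4adj : Fin 4 → Fin 4 → Bool
c4adj zero (suc zero) = true
c4adj zero (suc (suc (suc zero))) = true
c4adj (suc zero) zero = true
c4adj (suc zero) (suc (suc zero)) = true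
c4adj (suc (suc zero)) (suc zero) = true
c4adj (suc (suc zero)) (suc (suc (suc zero))) = true
c4adj (suc (suc (suc zero))) (suc (suc zero)) = true
c4adj (suc (suc (suc zero))) zero = true
c4adj _ _ = false

C4 : Graph 4
C4 = record { adj = c4adj ; sym = s ; irrefl = i }
  where
  s : ∀ u v → c4adj u v ≡ c4adj v u
  s zero zero = _≡_.refl
  s zero (suc zero) = _≡_.refl
  s zero (suc (suc zero)) = _≡_.refl
  s zero (suc (suc (suc zero))) = _≡_.refl
  s (suc zero) zero = _≡_.refl
  s (suc zero) (suc zero) = _≡_.refl
  s (suc zero) (suc (suc zero)) = _≡_.refl
  s (suc zero) (suc (suc (suc zero))) = _≡_.refl
  s (suc (suc zero)) zero = _≡_.refl
  s (suc (suc zero)) (suc zero) = _≡_.refl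
  s (suc (suc zero)) (suc (suc zero)) = _≡_.refl
  s (suc (suc zero)) (suc (suc (suc zero))) = _≡_.refl
  s (suc (suc (suc zero))) zero = _≡_.refl
  s (suc (suc (suc zero))) (suc zero) = _≡_.refl
  s (suc (suc (suc zero))) (suc (suc zero)) = _≡_.refl
  s (suc (suc (suc zero))) (suc (suc (suc zero))) = _≡_.refl
  i : ∀ v → c4adj v v ≡ false
  i zero = _≡_.refl
  i (suc zero) = _≡_.refl
  i (suc (suc zero)) = _≡_.refl
  i (suc (suc (suc zero))) = _≡_.refl

Dominating : ∀ {n} → Graph n → Subset n → Set
Dominating G D = ∀ v → v ∉ D → ∃[ u ] (u ∈ D × Adj G v u)

multiplicity : ∀ {n k} → Vec (Subset n) k → Fin n → ℕ
multiplicity [] v = 0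
multiplicity (D ∷ Ds) v with Data.Vec.lookup D v
... | true  = suc (multiplicity Ds v)
... | false = multiplicity Ds v

-- a (k,s)-configuration: k dominating sets (a multiset, given as a
-- length-k vector), every vertex in at most s of them; k, s positive
Configuration : ∀ {n} → Graph n → ℕ → ℕ → Set
Configuration {n} G k s =
  Σ (Vec (Subset n) k) λ Ds →
    All (Dominating G) Ds × (∀ v → multiplicity Ds v ≤ s)

-- FD(G) > 2  ⇔  some (k,s)-configuration with k,s ≥ 1 and k/s > 2
FD>2 : ∀ {n} → Graph n → Set
FD>2 G = ∃[ k ] ∃[ s ] (1 ≤ k × 1 ≤ s × 2 * s < k × Configuration G k s)

-- Call v a fork vertex if it has neighbours a ≠ b with further neighbours
-- x of a and y of b such that x ≠ y and x, y ≠ v.  At a fork vertex v one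
-- can 2-colour the graph so that v sees both colours and every other vertex
-- has a neighbour ≠ v of the opposite colour: start from a colouring in which
-- a and b already have such neighbours and flip the remaining bad vertices
-- one at a time, a flip never spoiling a good vertex.  Both colour classes
-- minus v are then disjoint dominating sets avoiding v.
-- If two adjacent vertices are not fork vertices, minimum degree 2 and
-- connectivity force G ≅ C4.  So every vertex is a fork vertex or adjacent
-- to one and the fork vertices F dominate.  Give every vertex x the pair of
-- its own fork vertex (x itself if x ∈ F, otherwise a neighbour in F): F
-- together with these n pairs is a (2n + 1, n)-configuration, because a pair
-- covers each vertex at most once and the pair given to x ∈ F misses x.

module Submission where

open import Defs hiding (sym)
open import Data.Bool using (Bool; true; false; T; not; _∨_)
open import Data.Bool.Properties
  using (T-≡; not-injective; not-¬; ¬-not; ∨-zeroʳ) renaming (_≟_ to _≟ᵇ_)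
open import Data.Fin using (Fin; zero; suc; _≟_)
open import Data.Fin.Patterns using (0F; 1F; 2F; 3F)
open import Data.Fin.Properties using (any?)
open import Data.Fin.Subset using (Subset; _∈_; _∉_; _⊆_; ⁅_⁆; _∩_; ∁)
open import Data.Fin.Subset.Properties
  using (_∈?_; p⊆q⇒∣p∣≤∣q∣; ∣⁅x⁆∣≡1; x∈⁅y⁆⇔x≡y; x≢y⇒x∉⁅y⁆; x∉⁅y⁆⇒x≢y;
         x∈p∩q⁺; x∈p∩q⁻; x∉p⇒x∈∁p; x∈∁p⇒x∉p)
open import Data.List using (List; []; _∷_; allFin)
open import Data.List.Membership.Propositional using () renaming (_∈_ to _∈ˡ_)
open import Data.List.Membership.Propositional.Properties using (∈-allFin)
open import Data.List.Relation.Unary.Any using (here; there)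
open import Data.Nat using (zero; suc; _*_; _≤_; _<_; z≤n; s≤s)
open import Data.Nat.Properties using (≤-refl; ≤-trans; ≤-reflexive; n≤1+n; 1+n≰n; *-comm; module ≤-Reasoning)
open import Data.Product using (∃; ∃-syntax; _×_; _,_; proj₁; proj₂)
open import Data.Sum using (_⊎_; inj₁; inj₂; [_,_]′)
open import Data.Vec using (Vec; []; _∷_; tabulate; lookup)
open import Data.Vec.Functional using (updateAt)
open import Data.Vec.Functional.Properties using (updateAt-updates; updateAt-minimal)
open import Data.Vec.Properties using (lookup∘tabulate; []=⇒lookup; lookup⇒[]=)
open import Data.Vec.Relation.Unary.All using (All; []; _∷_)
open import Function using (_∘_; Inverse; Equivalence)
open import Function.Bundles using (mk⤖)
open import Function.Consequences.Propositional using (strictlySurjective⇒surjective)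
open import Function.Construct.Symmetry using (↔-sym)
open import Function.Definitions using (Injective)
open import Function.Properties.Bijection using (⤖⇒↔)
open import Relation.Nullary using (¬_; Dec; yes; no; does; contradiction)
open import Relation.Nullary.Decidable using (T?; ¬?; _×-dec_; map′; dec-true; dec-false; decidable-stable)
open import Relation.Binary.PropositionalEquality
  using (_≡_; _≢_; refl; sym; trans; cong; cong₂; subst; subst₂; module ≡-Reasoning)

∈-tabulate⁺ : ∀ {n} {f : Fin n → Bool} {x} → f x ≡ true → x ∈ tabulate f
∈-tabulate⁺ {f = f} {x} fx = lookup⇒[]= x (tabulate f) (trans (lookup∘tabulate f x) fx)

∈-tabulate⁻ : ∀ {n} {f : Fin n → Bool} {x} → x ∈ tabulate f → f x ≡ true
∈-tabulate⁻ {f = f} {x} x∈ = trans (sym (lookup∘tabulate f x)) ([]=⇒lookup x∈)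

module _ {n} (G : Graph n) where

  Adj-sym : ∀ {u w} → Adj G u w → Adj G w u
  Adj-sym {u} {w} = subst T (Graph.sym G u w)

  Adj⇒≢ : ∀ {u w} → Adj G u w → u ≢ w
  Adj⇒≢ {u} u~u refl = subst T (irrefl G u) u~u

  adj-true : ∀ {u w} → Adj G u w → adj G u w ≡ true
  adj-true = Equivalence.to T-≡

  adj-false : ∀ {u w} → ¬ Adj G u w → adj G u w ≡ false
  adj-false ¬u~w = ¬-not (¬u~w ∘ Equivalence.from T-≡)

  ∈N⇒Adj : ∀ {p t} → t ∈ N G p → Adj G p t
  ∈N⇒Adj = Equivalence.from T-≡ ∘ ∈-tabulate⁻

  neighbour-≢ : MinDegreeAtLeast G 2 → ∀ p q → ∃[ t ] (Adj G p t × t ≢ q)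
  neighbour-≢ δ p q with any? (λ t → T? (adj G p t) ×-dec ¬? (t ≟ q))
  ... | yes found = found
  ... | no none = contradiction (≤-trans (δ p) degree≤1) 1+n≰n
    where
    N⊆⁅q⁆ : N G p ⊆ ⁅ q ⁆
    N⊆⁅q⁆ {t} t∈N = Equivalence.from x∈⁅y⁆⇔x≡y
      (decidable-stable (t ≟ q) (λ t≢q → none (t , ∈N⇒Adj t∈N , t≢q)))

    degree≤1 : degree G p ≤ 1
    degree≤1 = ≤-trans (p⊆q⇒∣p∣≤∣q∣ N⊆⁅q⁆) (≤-reflexive (∣⁅x⁆∣≡1 q))

  walk-preserves : ∀ {ℓ} (P : Fin n → Set ℓ) → (∀ {p q} → P p → Adj G p q → P q) →
                   ∀ {p q} → Walk G p q → P p → P q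
  walk-preserves P closed here       Pp = Pp
  walk-preserves P closed (step a w) Pp = walk-preserves P closed w (closed Pp a)

  NeighboursAmong : Fin n → Fin n → Fin n → Set
  NeighboursAmong p q r = ∀ {t} → Adj G p t → t ≡ q ⊎ t ≡ r

Isomorphic-sym : ∀ {n m} {G : Graph n} {H : Graph m} → Isomorphic G H → Isomorphic H G
Isomorphic-sym {G = G} {H} (f , preserves) = ↔-sym f , λ u v →
  begin
    adj H u v                          ≡⟨ cong₂ (adj H) (sym (strictlyInverseˡ u)) (sym (strictlyInverseˡ v)) ⟩
    adj H (to (from u)) (to (from v))  ≡⟨ sym (preserves (from u) (from v)) ⟩
    adj G (from u) (from v)            ∎
  where
  open Inverse f
  open ≡-Reasoning

-- No vertex of C4 is a fork vertex: both walks of length two from a vertex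
-- that do not return to it end at the opposite vertex.
record Fork {n} (G : Graph n) (v : Fin n) : Set where
  field
    a b x y : Fin n
    v~a : Adj G v a
    v~b : Adj G v b
    a≢b : a ≢ b
    a~x : Adj G a x
    x≢v : x ≢ v
    b~y : Adj G b y
    y≢v : y ≢ v
    x≢y : x ≢ y

fork? : ∀ {n} (G : Graph n) v → Dec (Fork G v)
fork? G v = map′
  (λ { (a , b , x , y , v~a , v~b , a≢b , a~x , x≢v , b~y , y≢v , x≢y) →
       record { v~a = v~a ; v~b = v~b ; a≢b = a≢b ; a~x = a~x ; x≢v = x≢v
              ; b~y = b~y ; y≢v = y≢v ; x≢y = x≢y } })
  (λ f → let open Fork f in a , b , x , y , v~a , v~b , a≢b , a~x , x≢v , b~y , y≢v , x≢y)
  (any? λ a → any? λ b → any? λ x → any? λ y →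
     T? (adj G v a) ×-dec T? (adj G v b) ×-dec ¬? (a ≟ b) ×-dec T? (adj G a x) ×-dec
     ¬? (x ≟ v) ×-dec T? (adj G b y) ×-dec ¬? (y ≟ v) ×-dec ¬? (x ≟ y))

forkless-neighbours : ∀ {n} {G : Graph n} {p q r s} → ¬ Fork G p →
                      Adj G p q → Adj G p r → q ≢ r → Adj G r s → s ≢ p →
                      NeighboursAmong G q p s
forkless-neighbours {p = p} {q} {r} {s} ¬fork p~q p~r q≢r r~s s≢p {t} q~t with t ≟ p
... | yes t≡p = inj₁ t≡p
... | no t≢p  = inj₂ (decidable-stable (t ≟ s) λ t≢s → ¬fork record
  { v~a = p~r ; v~b = p~q ; a≢b = q≢r ∘ sym ; a~x = r~s ; x≢v = s≢p
  ; b~y = q~t ; y≢v = t≢p ; x≢y = t≢s ∘ sym })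

record DisjointDominatingPair {n} (G : Graph n) (v : Fin n) : Set where
  field
    first second      : Subset n
    first-dominating  : Dominating G first
    second-dominating : Dominating G second
    v∉first           : v ∉ first
    v∉second          : v ∉ second
    disjoint          : ∀ {u} → u ∈ first → u ∉ second

module Colourings {n} (G : Graph n) (v : Fin n) (escape : ∀ u → ∃[ t ] (Adj G u t × t ≢ v)) where

  Colouring : Set
  Colouring = Fin n → Bool

  Opposed : Colouring → Fin n → Set
  Opposed c u = ∃[ t ] (Adj G u t × t ≢ v × c t ≢ c u)

  opposed? : ∀ c u → Dec (Opposed c u)
  opposed? c u = any? λ t → T? (adj G u t) ×-dec ¬? (t ≟ v) ×-dec ¬? (c t ≟ᵇ c u)

  Proper : Colouring → Set
  Proper c = ∀ {u} → u ≢ v → Opposed c u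

  _⊑_ : Colouring → Colouring → Set
  c ⊑ c′ = ∀ {u} → u ≢ v → Opposed c u → Opposed c′ u × c′ u ≡ c u

  ⊑-trans : ∀ {c c′ c″} → c ⊑ c′ → c′ ⊑ c″ → c ⊑ c″
  ⊑-trans c⊑c′ c′⊑c″ u≢v opp with c⊑c′ u≢v opp
  ... | opp′ , c′u≡cu with c′⊑c″ u≢v opp′
  ...   | opp″ , c″u≡c′u = opp″ , trans c″u≡c′u c′u≡cu

  unopposed-monochromatic : ∀ {c w t} → ¬ Opposed c w → Adj G w t → t ≢ v → c t ≡ c w
  unopposed-monochromatic {c} {w} {t} ¬opp w~t t≢v =
    decidable-stable (c t ≟ᵇ c w) λ ct≢cw → ¬opp (t , w~t , t≢v , ct≢cw)

  recolour : Fin n → Colouring → Colouring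
  recolour w c with opposed? c w
  ... | yes _ = c
  ... | no _  = updateAt c w not

  recolour-opposed : ∀ {w} c → w ≢ v → Opposed (recolour w c) w
  recolour-opposed {w} c w≢v with opposed? c w
  ... | yes opp = opp
  ... | no ¬opp with escape w
  ...   | t , w~t , t≢v = t , w~t , t≢v , λ flipped≡ → not-¬ refl (begin
    c w                ≡⟨ sym (unopposed-monochromatic ¬opp w~t t≢v) ⟩
    c t                ≡⟨ sym (updateAt-minimal t w c (Adj⇒≢ G w~t ∘ sym)) ⟩
    updateAt c w not t ≡⟨ flipped≡ ⟩
    updateAt c w not w ≡⟨ updateAt-updates w c ⟩
    not (c w)          ∎)
    where open ≡-Reasoning

  -- A flip at an unopposed w cannot involve an opposed u or its witness t:
  -- either would make w opposed.
  recolour-⊑ : ∀ w c → c ⊑ recolour w c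
  recolour-⊑ w c {u} u≢v opp@(t , u~t , t≢v , ct≢cu) with opposed? c w
  ... | yes _ = opp , refl
  ... | no ¬opp = (t , u~t , t≢v , λ e → ct≢cu (trans (sym (keeps t t≢w)) (trans e (keeps u u≢w))))
                , keeps u u≢w
    where
    keeps : ∀ s → s ≢ w → updateAt c w not s ≡ c s
    keeps s s≢w = updateAt-minimal s w c s≢w

    u≢w : u ≢ w
    u≢w refl = ¬opp opp

    t≢w : t ≢ w
    t≢w refl = ¬opp (u , Adj-sym G u~t , u≢v , ct≢cu ∘ sym)

  recolourAll : List (Fin n) → Colouring → Colouring
  recolourAll []       c = c
  recolourAll (w ∷ ws) c = recolourAll ws (recolour w c)

  recolourAll-⊑ : ∀ ws c → c ⊑ recolourAll ws c
  recolourAll-⊑ []       c u≢v opp = opp , refl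
  recolourAll-⊑ (w ∷ ws) c = ⊑-trans (recolour-⊑ w c) (recolourAll-⊑ ws (recolour w c))

  recolourAll-opposed : ∀ {ws u} c → u ≢ v → u ∈ˡ ws → Opposed (recolourAll ws c) u
  recolourAll-opposed {w ∷ ws} c u≢v (here refl) =
    proj₁ (recolourAll-⊑ ws (recolour w c) u≢v (recolour-opposed c u≢v))
  recolourAll-opposed {w ∷ ws} c u≢v (there u∈ws) = recolourAll-opposed (recolour w c) u≢v u∈ws

  proper-refinement : ∀ c → ∃[ c′ ] (c ⊑ c′ × Proper c′)
  proper-refinement c =
    recolourAll (allFin n) c , recolourAll-⊑ (allFin n) c , λ u≢v → recolourAll-opposed c u≢v (∈-allFin _)

  colourClass : Colouring → Subset n
  colourClass c = tabulate c ∩ ∁ ⁅ v ⁆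

  ∈-colourClass⁺ : ∀ {c u} → c u ≡ true → u ≢ v → u ∈ colourClass c
  ∈-colourClass⁺ cu u≢v = x∈p∩q⁺ (∈-tabulate⁺ cu , x∉p⇒x∈∁p (x≢y⇒x∉⁅y⁆ u≢v))

  ∈-colourClass⁻ : ∀ {c u} → u ∈ colourClass c → c u ≡ true × u ≢ v
  ∈-colourClass⁻ {c} u∈ with x∈p∩q⁻ (tabulate c) _ u∈
  ... | u∈c , u∈∁ = ∈-tabulate⁻ u∈c , x∉⁅y⁆⇒x≢y (x∈∁p⇒x∉p u∈∁)

  colourClass-dominating : ∀ {c a} → Proper c → Adj G v a → c a ≡ true → Dominating G (colourClass c)
  colourClass-dominating {c} {a} proper v~a ca u u∉ with u ≟ v
  ... | yes refl = a , ∈-colourClass⁺ ca (Adj⇒≢ G v~a ∘ sym) , v~a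
  ... | no u≢v with proper u≢v
  ...   | t , u~t , t≢v , ct≢cu = t , ∈-colourClass⁺ ct t≢v , u~t
    where
    cu : c u ≡ false
    cu = ¬-not (λ cu → u∉ (∈-colourClass⁺ cu u≢v))

    ct : c t ≡ true
    ct = trans (¬-not ct≢cu) (cong not cu)

  proper-not : ∀ {c} → Proper c → Proper (not ∘ c)
  proper-not proper u≢v with proper u≢v
  ... | t , u~t , t≢v , ct≢cu = t , u~t , t≢v , ct≢cu ∘ not-injective

  colourClasses : ∀ {c a b} → Proper c → Adj G v a → Adj G v b → c a ≡ true → c b ≡ false →
                  DisjointDominatingPair G v
  colourClasses {c} proper v~a v~b ca cb = record
    { first             = colourClass c
    ; second            = colourClass (not ∘ c)
    ; first-dominating  = colourClass-dominating proper v~a ca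
    ; second-dominating = colourClass-dominating (proper-not proper) v~b (cong not cb)
    ; v∉first           = λ v∈ → proj₂ (∈-colourClass⁻ v∈) refl
    ; v∉second          = λ v∈ → proj₂ (∈-colourClass⁻ v∈) refl
    ; disjoint          = λ u∈first u∈second →
        not-¬ refl (trans (proj₁ (∈-colourClass⁻ u∈first)) (sym (proj₁ (∈-colourClass⁻ u∈second))))
    }

  module _ (f : Fork G v) where
    open Fork f

    -- Colouring a and y true, the walks v a x and v b y make a and b opposed.
    private
      c₀ : Colouring
      c₀ u = does (u ≟ a) ∨ does (u ≟ y)

      c₀a : c₀ a ≡ true
      c₀a rewrite dec-true (a ≟ a) refl = refl

      c₀y : c₀ y ≡ true
      c₀y rewrite dec-true (y ≟ y) refl = ∨-zeroʳ _

      c₀b : c₀ b ≡ false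
      c₀b rewrite dec-false (b ≟ a) (a≢b ∘ sym) | dec-false (b ≟ y) (Adj⇒≢ G b~y) = refl

      c₀x : c₀ x ≡ false
      c₀x rewrite dec-false (x ≟ a) (Adj⇒≢ G a~x ∘ sym) | dec-false (x ≟ y) x≢y = refl

      a-opposed : Opposed c₀ a
      a-opposed = x , a~x , x≢v , subst₂ _≢_ (sym c₀x) (sym c₀a) λ ()

      b-opposed : Opposed c₀ b
      b-opposed = y , b~y , y≢v , subst₂ _≢_ (sym c₀y) (sym c₀b) λ ()

    fork⇒pair : DisjointDominatingPair G v
    fork⇒pair with proper-refinement c₀
    ... | c , c₀⊑c , proper = colourClasses proper v~a v~b
      (trans (proj₂ (c₀⊑c (Adj⇒≢ G v~a ∘ sym) a-opposed)) c₀a)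
      (trans (proj₂ (c₀⊑c (Adj⇒≢ G v~b ∘ sym) b-opposed)) c₀b)

multiplicity-∉ : ∀ {n k} {D : Subset n} (Ds : Vec (Subset n) k) {x} →
                 x ∉ D → multiplicity (D ∷ Ds) x ≡ multiplicity Ds x
multiplicity-∉ {D = D} Ds {x} x∉D with lookup D x in eq
... | true  = contradiction (lookup⇒[]= x D eq) x∉D
... | false = refl

multiplicity-∷-≤ : ∀ {n k} (D : Subset n) (Ds : Vec (Subset n) k) x →
                   multiplicity (D ∷ Ds) x ≤ suc (multiplicity Ds x)
multiplicity-∷-≤ D Ds x with lookup D x
... | true  = ≤-refl
... | false = n≤1+n _

module _ {n} {G : Graph n} {v} (P : DisjointDominatingPair G v) where
  open DisjointDominatingPair P

  multiplicity-pair-≤ : ∀ {k} (Ds : Vec (Subset n) k) x →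
                        multiplicity (first ∷ second ∷ Ds) x ≤ suc (multiplicity Ds x)
  multiplicity-pair-≤ Ds x with x ∈? first
  ... | yes x∈first = ≤-trans (multiplicity-∷-≤ first (second ∷ Ds) x)
                              (s≤s (≤-reflexive (multiplicity-∉ Ds (disjoint x∈first))))
  ... | no  x∉first = ≤-trans (≤-reflexive (multiplicity-∉ (second ∷ Ds) x∉first))
                              (multiplicity-∷-≤ second Ds x)

  multiplicity-pair-centre : ∀ {k} (Ds : Vec (Subset n) k) →
                             multiplicity (first ∷ second ∷ Ds) v ≡ multiplicity Ds v
  multiplicity-pair-centre Ds = trans (multiplicity-∉ (second ∷ Ds) v∉first) (multiplicity-∉ Ds v∉second)

module _ {n} {G : Graph n} where
  open DisjointDominatingPair

  flatten : ∀ {k} → (Fin k → ∃ (DisjointDominatingPair G)) → Vec (Subset n) (k * 2)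
  flatten {zero}  P = []
  flatten {suc k} P = first (proj₂ (P zero)) ∷ second (proj₂ (P zero)) ∷ flatten (P ∘ suc)

  flatten-dominating : ∀ {k} (P : Fin k → ∃ (DisjointDominatingPair G)) →
                       All (Dominating G) (flatten P)
  flatten-dominating {zero}  P = []
  flatten-dominating {suc k} P =
    first-dominating (proj₂ (P zero)) ∷ second-dominating (proj₂ (P zero)) ∷ flatten-dominating (P ∘ suc)

  multiplicity-flatten-≤ : ∀ {k} (P : Fin k → ∃ (DisjointDominatingPair G)) x →
                           multiplicity (flatten P) x ≤ k
  multiplicity-flatten-≤ {zero}  P x = z≤n
  multiplicity-flatten-≤ {suc k} P x = begin
    multiplicity (flatten P) x              ≤⟨ multiplicity-pair-≤ (proj₂ (P zero)) (flatten (P ∘ suc)) x ⟩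
    suc (multiplicity (flatten (P ∘ suc)) x) ≤⟨ s≤s (multiplicity-flatten-≤ (P ∘ suc) x) ⟩
    suc k                                    ∎
    where open ≤-Reasoning

  multiplicity-flatten-< : ∀ {k} (P : Fin k → ∃ (DisjointDominatingPair G)) {x} i →
                           proj₁ (P i) ≡ x → multiplicity (flatten P) x < k
  multiplicity-flatten-< {suc k} P zero refl = s≤s (begin
    multiplicity (flatten P) _         ≡⟨ multiplicity-pair-centre (proj₂ (P zero)) (flatten (P ∘ suc)) ⟩
    multiplicity (flatten (P ∘ suc)) _ ≤⟨ multiplicity-flatten-≤ (P ∘ suc) _ ⟩
    k                                  ∎)
    where open ≤-Reasoning
  multiplicity-flatten-< {suc k} P {x} (suc i) centre≡x = s≤s (begin
    multiplicity (flatten P) x               ≤⟨ multiplicity-pair-≤ (proj₂ (P zero)) (flatten (P ∘ suc)) x ⟩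
    suc (multiplicity (flatten (P ∘ suc)) x) ≤⟨ multiplicity-flatten-< (P ∘ suc) i centre≡x ⟩
    k                                        ∎)
    where open ≤-Reasoning

module ForklessEdge {n} (G : Graph n) (δ : MinDegreeAtLeast G 2) (connected : ∀ p q → Walk G p q)
                    {w u} (w~u : Adj G w u) (¬fork-w : ¬ Fork G w) (¬fork-u : ¬ Fork G u) where

  private
    u′ : Fin n
    u′ = proj₁ (neighbour-≢ G δ w u)

    w~u′ : Adj G w u′
    w~u′ = proj₁ (proj₂ (neighbour-≢ G δ w u))

    u′≢u : u′ ≢ u
    u′≢u = proj₂ (proj₂ (neighbour-≢ G δ w u))

    z : Fin n
    z = proj₁ (neighbour-≢ G δ u′ w)

    u′~z : Adj G u′ z
    u′~z = proj₁ (proj₂ (neighbour-≢ G δ u′ w))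

    z≢w : z ≢ w
    z≢w = proj₂ (proj₂ (neighbour-≢ G δ u′ w))

    N[u] : NeighboursAmong G u w z
    N[u] = forkless-neighbours ¬fork-w w~u w~u′ (u′≢u ∘ sym) u′~z z≢w

    u~z : Adj G u z
    u~z with neighbour-≢ G δ u w
    ... | t , u~t , t≢w with N[u] u~t
    ...   | inj₁ t≡w = contradiction t≡w t≢w
    ...   | inj₂ refl = u~t

    N[u′] : NeighboursAmong G u′ w z
    N[u′] = forkless-neighbours ¬fork-w w~u′ w~u u′≢u u~z z≢w

    N[z] : NeighboursAmong G z u u′
    N[z] = forkless-neighbours ¬fork-u u~z (Adj-sym G w~u) z≢w w~u′ u′≢u

    N[w] : NeighboursAmong G w u u′
    N[w] = forkless-neighbours ¬fork-u (Adj-sym G w~u) u~z (z≢w ∘ sym) (Adj-sym G u′~z) u′≢u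

    corner : Fin 4 → Fin n
    corner 0F = w
    corner 1F = u
    corner 2F = z
    corner 3F = u′

    among : ∀ i j {t} → t ≡ corner i ⊎ t ≡ corner j → ∃[ k ] corner k ≡ t
    among i j = [ (λ t≡i → i , sym t≡i) , (λ t≡j → j , sym t≡j) ]′

    corner-closed : ∀ i {t} → Adj G (corner i) t → ∃[ k ] corner k ≡ t
    corner-closed 0F = among 1F 3F ∘ N[w]
    corner-closed 1F = among 0F 2F ∘ N[u]
    corner-closed 2F = among 1F 3F ∘ N[z]
    corner-closed 3F = among 0F 2F ∘ N[u′]

    corner-surjective : ∀ t → ∃[ i ] corner i ≡ t
    corner-surjective t = walk-preserves G (λ t → ∃[ i ] corner i ≡ t)
      (λ { (i , refl) → corner-closed i }) (connected w t) (0F , refl)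

    w≢u : w ≢ u
    w≢u = Adj⇒≢ G w~u

    w≢z : w ≢ z
    w≢z = z≢w ∘ sym

    w≢u′ : w ≢ u′
    w≢u′ = Adj⇒≢ G w~u′

    u≢z : u ≢ z
    u≢z = Adj⇒≢ G u~z

    u≢u′ : u ≢ u′
    u≢u′ = u′≢u ∘ sym

    z≢u′ : z ≢ u′
    z≢u′ = Adj⇒≢ G u′~z ∘ sym

    corner-injective : Injective _≡_ _≡_ corner
    corner-injective {0F} {0F} _ = refl
    corner-injective {0F} {1F} e = contradiction e w≢u
    corner-injective {0F} {2F} e = contradiction e w≢z
    corner-injective {0F} {3F} e = contradiction e w≢u′
    corner-injective {1F} {0F} e = contradiction (sym e) w≢u
    corner-injective {1F} {1F} _ = refl
    corner-injective {1F} {2F} e = contradiction e u≢z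
    corner-injective {1F} {3F} e = contradiction e u≢u′
    corner-injective {2F} {0F} e = contradiction (sym e) w≢z
    corner-injective {2F} {1F} e = contradiction (sym e) u≢z
    corner-injective {2F} {2F} _ = refl
    corner-injective {2F} {3F} e = contradiction e z≢u′
    corner-injective {3F} {0F} e = contradiction (sym e) w≢u′
    corner-injective {3F} {1F} e = contradiction (sym e) u≢u′
    corner-injective {3F} {2F} e = contradiction (sym e) z≢u′
    corner-injective {3F} {3F} _ = refl

    ¬w~z : ¬ Adj G w z
    ¬w~z w~z = [ u≢z ∘ sym , z≢u′ ]′ (N[w] w~z)

    ¬u~u′ : ¬ Adj G u u′
    ¬u~u′ u~u′ = [ w≢u′ ∘ sym , z≢u′ ∘ sym ]′ (N[u] u~u′)

    corner-adj : ∀ i j → adj G (corner i) (corner j) ≡ c4adj i j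
    corner-adj 0F 0F = irrefl G w
    corner-adj 0F 1F = adj-true G w~u
    corner-adj 0F 2F = adj-false G ¬w~z
    corner-adj 0F 3F = adj-true G w~u′
    corner-adj 1F 0F = adj-true G (Adj-sym G w~u)
    corner-adj 1F 1F = irrefl G u
    corner-adj 1F 2F = adj-true G u~z
    corner-adj 1F 3F = adj-false G ¬u~u′
    corner-adj 2F 0F = adj-false G (¬w~z ∘ Adj-sym G)
    corner-adj 2F 1F = adj-true G (Adj-sym G u~z)
    corner-adj 2F 2F = irrefl G z
    corner-adj 2F 3F = adj-true G (Adj-sym G u′~z)
    corner-adj 3F 0F = adj-true G (Adj-sym G w~u′)
    corner-adj 3F 1F = adj-false G (¬u~u′ ∘ Adj-sym G)
    corner-adj 3F 2F = adj-true G u′~z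
    corner-adj 3F 3F = irrefl G u′

  isomorphic : Isomorphic G C4
  isomorphic = Isomorphic-sym {G = C4} {H = G}
    ( ⤖⇒↔ (mk⤖ (corner-injective , strictlySurjective⇒surjective corner-surjective))
    , λ i j → sym (corner-adj i j))

module _ {n} (G : Graph n) (connected : ∀ p q → Walk G p q) (δ : MinDegreeAtLeast G 2)
         (¬C4 : ¬ Isomorphic G C4) where

  fork-nearby : ∀ {x} → ¬ Fork G x → ∃[ u ] (Adj G x u × Fork G u)
  fork-nearby {x} ¬fork-x with neighbour-≢ G δ x x
  ... | u , x~u , _ with fork? G u
  ...   | yes fork-u  = u , x~u , fork-u
  ...   | no  ¬fork-u = contradiction (ForklessEdge.isomorphic G δ connected x~u ¬fork-x ¬fork-u) ¬C4

  forkCentre : Fin n → ∃ (Fork G)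
  forkCentre x with fork? G x
  ... | yes fork-x  = x , fork-x
  ... | no  ¬fork-x = proj₁ (fork-nearby ¬fork-x) , proj₂ (proj₂ (fork-nearby ¬fork-x))

  forkCentre-fork : ∀ {x} → Fork G x → proj₁ (forkCentre x) ≡ x
  forkCentre-fork {x} fork-x with fork? G x
  ... | yes _       = refl
  ... | no  ¬fork-x = contradiction fork-x ¬fork-x

  forkVertices : Subset n
  forkVertices = tabulate (λ x → does (fork? G x))

  fork⇒∈forkVertices : ∀ {x} → Fork G x → x ∈ forkVertices
  fork⇒∈forkVertices {x} fork-x = ∈-tabulate⁺ (dec-true (fork? G x) fork-x)

  ¬fork⇒∉forkVertices : ∀ {x} → ¬ Fork G x → x ∉ forkVertices
  ¬fork⇒∉forkVertices {x} ¬fork-x x∈ =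
    contradiction (trans (sym (∈-tabulate⁻ x∈)) (dec-false (fork? G x) ¬fork-x)) λ ()

  forkVertices-dominating : Dominating G forkVertices
  forkVertices-dominating x x∉ with fork-nearby (x∉ ∘ fork⇒∈forkVertices)
  ... | u , x~u , fork-u = u , fork⇒∈forkVertices fork-u , x~u

  centredPair : Fin n → ∃ (DisjointDominatingPair G)
  centredPair x = v , Colourings.fork⇒pair G v (λ t → neighbour-≢ G δ t v) (proj₂ (forkCentre x))
    where v = proj₁ (forkCentre x)

  configuration : Configuration G (suc (n * 2)) n
  configuration = forkVertices ∷ flatten centredPair
                , forkVertices-dominating ∷ flatten-dominating centredPair
                , multiplicity≤n
    where
    multiplicity≤n : ∀ x → multiplicity (forkVertices ∷ flatten centredPair) x ≤ n
    multiplicity≤n x with fork? G x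
    ... | yes fork-x  = ≤-trans (multiplicity-∷-≤ forkVertices (flatten centredPair) x)
                                (multiplicity-flatten-< centredPair x (forkCentre-fork fork-x))
    ... | no  ¬fork-x =
      ≤-trans (≤-reflexive (multiplicity-∉ (flatten centredPair) (¬fork⇒∉forkVertices ¬fork-x)))
              (multiplicity-flatten-≤ centredPair x)

theorem7 : ∀ {n} (G : Graph n) → Connected G → MinDegreeAtLeast G 2 →
    ¬ Isomorphic G C4 → FD>2 G
theorem7 {zero}  G ()
theorem7 {suc m} G connected δ ¬C4 =
  suc (n * 2) , n , s≤s z≤n , s≤s z≤n , s≤s (≤-reflexive (*-comm 2 n))
  , configuration G connected δ ¬C4
  where
  n = suc m
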